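{- For all integers $n,m,p\ge0$, \[ \mathcal{Z}_{n+1,m}(x;p)=\frac{m+1}{m+p+1}\mathcal{Z}_{n,m+1}(x;p)+(m+x)\,\mathcal{Z}_{n,m}(x;p), \] and $\mathcal{Z}_{0,m}(x;p)=1$.
   Context: $s(m,k)$ are the signed Stirling numbers of the first kind, $x(x-1)\cdots(x-m+1)=\sum_{k=0}^m s(m,k)x^k$. For an integer $p\ge0$, the $p$-Bell numbers $\mathcal{B}_{n,p}$ are defined by $\sum_{n\geq0}\mathcal{B}_{n,p}\frac{z^{n}}{n!}=\sum_{k\geq0}\binom{k+p}{p}^{ -1}\frac{(e^{z}-1)^{k}}{k!}$. Let $\mathcal{Z}_{n,m}(p)=\binom{m+p}{p}\sum_{k=0}^{m}s(m,k)\mathcal{B}_{n+k,p}$, and define the polynomials $\mathcal{Z}_{n,m}(x;p)=\sum_{k=0}^{n}\binom{n}{k}\mathcal{Z}_{k,m}(p)x^{n-k}$. -}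

module Defs where

open import Data.Nat using (ℕ; zero; suc; _+_; _∸_)
open import Data.Nat.Combinatorics using (_C_)
open import Data.Integer using (ℤ; +_)
import Data.Integer as ℤ
open import Data.Rational using (ℚ; _/_; 0ℚ; 1ℚ)
import Data.Rational as ℚ

natℚ : ℕ → ℚ
natℚ n = (+ n) / 1

-- Signed Stirling numbers of the first kind:
-- x(x-1)...(x-m+1) = Σ_k s(m,k) x^k, via s(m+1,k+1) = s(m,k) - m s(m,k+1).
stirling1 : ℕ → ℕ → ℤ
stirling1 zero    zero    = + 1
stirling1 zero    (suc k) = + 0
stirling1 (suc m) zero    = + 0
stirling1 (suc m) (suc k) = stirling1 m k ℤ.- (+ m) ℤ.* stirling1 m (suc k)

-- Stirling numbers of the second kind: (e^z-1)^k/k! = Σ_n S(n,k) z^n/n!.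
stirling2 : ℕ → ℕ → ℕ
stirling2 zero    zero    = 1
stirling2 zero    (suc k) = 0
stirling2 (suc n) zero    = 0
stirling2 (suc n) (suc k) = suc k Data.Nat.* stirling2 n (suc k) Data.Nat.+ stirling2 n k

sumTo : ℕ → (ℕ → ℚ) → ℚ
sumTo zero    f = f 0
sumTo (suc n) f = sumTo n f ℚ.+ f (suc n)

pow : ℚ → ℕ → ℚ
pow x zero    = 1ℚ
pow x (suc n) = x ℚ.* pow x n

-- reciprocal of a natural number (only applied to binomials C(k+p,p) ≥ 1)
recipℕ : ℕ → ℚ
recipℕ zero    = 0ℚ
recipℕ (suc n) = (+ 1) / suc n

-- p-Bell numbers: n![z^n] Σ_k C(k+p,p)^{-1} (e^z-1)^k/k!  =  Σ_{k=0}^{n} S(n,k) / C(k+p,p)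
pBell : ℕ → ℕ → ℚ
pBell n p = sumTo n (λ k → natℚ (stirling2 n k) ℚ.* recipℕ ((k + p) C p))

Zn : ℕ → ℕ → ℕ → ℚ
Zn n m p = natℚ ((m + p) C p) ℚ.*
           sumTo m (λ k → (stirling1 m k / 1) ℚ.* pBell (n + k) p)

Zpoly : ℕ → ℕ → ℕ → ℚ → ℚ
Zpoly n m p x = sumTo n (λ k → natℚ (n C k) ℚ.* Zn k m p ℚ.* pow x (n ∸ k))

-- Write (s b)_m = Σ_{k≤m} s(m,k) b_k and (S a)_n = Σ_{j≤n} S(n,j) a_j for the two
-- Stirling transforms.  Then B_{n,p} = (S a)_n with a_j = C(j+p,p)⁻¹, and
-- Z_{n,m}(p) = C(m+p,p) · (s b)_m with b_k = B_{n+k,p}.  The recurrence of s gives (s b)_{m+1} = (s (b∘suc))_m − m (s b)_m;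
--     the recurrence of S gives (S a)_{n+1} = (S a′)_n with a′_j = j a_j + a_{j+1}.  Together
--     they yield Stirling inversion (s (S a))_m = a_m, whence Z_{0,m}(p) = C(m+p,p)·C(m+p,p)⁻¹ = 1.
--  2. The numbers Z_{n,m}(p).  The first transform step, together with the absorption identity
--     C(m+p,p)(m+p+1) = C(m+1+p,p)(m+1), gives
--     Z_{n+1,m}(p) = (m+1)/(m+p+1) · Z_{n,m+1}(p) + m · Z_{n,m}(p).
--  3. Binomial series Σ_{k≤n} C(n,k) c_k x^{n-k}.  By Pascal's rule, a recurrence
--     c_{k+1} = α d_k + β c_k lifts to the series with β replaced by β + x; applied to
--     c_k = Z_{k,m}(p) this is the theorem.

module Submission where

open import Defs
open import Data.Nat using (ℕ; suc)
import Data.Nat as ℕ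
open import Data.Integer using (+_)
open import Data.Rational using (ℚ; _/_; _*_; _+_; 1ℚ)
open import Data.Product using (_×_)
open import Relation.Binary.PropositionalEquality using (_≡_)

open import Data.Nat using (zero; _≤_; _<_; z≤n; s≤s; _!; NonZero)
import Data.Nat.Properties as ℕP
open import Data.Nat.Combinatorics
  using (_C_; nCk≡n!/k![n-k]!; k![n∸k]!∣n!; nCk+nC[k+1]≡[n+1]C[k+1]; k>n⇒nCk≡0)
open import Data.Nat.DivMod using (m/n*n≡m)
open import Data.Integer using (ℤ)
import Data.Integer as ℤ
import Data.Integer.Properties as ℤP
open import Data.Rational using (mkℚ; _-_; -_; 0ℚ; toℚᵘ)
import Data.Rational.Properties as ℚP
import Data.Rational.Unnormalised as ℚᵘ
import Data.Rational.Unnormalised.Properties as ℚᵘP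
open import Data.Nat.Coprimality using (1-coprimeTo)
import Data.Nat.Coprimality as Coprimality
open import Data.Product using (_,_)
open import Relation.Binary.PropositionalEquality
  using (refl; sym; trans; cong; cong₂; subst; module ≡-Reasoning)
open ≡-Reasoning
open import Algebra.Bundles using (CommutativeMonoid)
open import Algebra.Properties.CommutativeSemigroup
  (CommutativeMonoid.commutativeSemigroup ℚP.+-0-commutativeMonoid)
  using () renaming (interchange to +-interchange)
open import Algebra.Properties.CommutativeSemigroup ℕP.*-commutativeSemigroup
  using (xy∙z≈y∙xz; x∙yz≈y∙xz)
open import Data.Rational.Solver using (module +-*-Solver)
open +-*-Solver using (solve; _:+_; _:*_; _:-_; _:=_)

-- The canonical representative of an integer; arithmetic on it computes.
private
  ι : ℤ → ℚ
  ι i = mkℚ i 0 (Coprimality.sym (1-coprimeTo ℤ.∣ i ∣))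

  /1≡ι : ∀ i → i / 1 ≡ ι i
  /1≡ι (+ n)      = ℚP.normalize-coprime (Coprimality.sym (1-coprimeTo n))
  /1≡ι ℤ.-[1+ n ] = cong -_ (ℚP.normalize-coprime (Coprimality.sym (1-coprimeTo (suc n))))

  ι-neg : ∀ i → ι (ℤ.- i) ≡ - ι i
  ι-neg (+ zero)   = refl
  ι-neg (+ suc n)  = refl
  ι-neg ℤ.-[1+ n ] = refl

/1-homo-+ : ∀ i j → (i ℤ.+ j) / 1 ≡ i / 1 + j / 1
/1-homo-+ i j = begin
  (i ℤ.+ j) / 1                 ≡⟨ cong₂ (λ u v → (u ℤ.+ v) / 1) (sym (ℤP.*-identityʳ i)) (sym (ℤP.*-identityʳ j)) ⟩
  (i ℤ.* + 1 ℤ.+ j ℤ.* + 1) / 1  ≡⟨⟩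
  ι i + ι j                     ≡⟨ cong₂ _+_ (sym (/1≡ι i)) (sym (/1≡ι j)) ⟩
  i / 1 + j / 1                 ∎

/1-homo-* : ∀ i j → (i ℤ.* j) / 1 ≡ (i / 1) * (j / 1)
/1-homo-* i j = cong₂ _*_ (sym (/1≡ι i)) (sym (/1≡ι j))

/1-homo-neg : ∀ i → (ℤ.- i) / 1 ≡ - (i / 1)
/1-homo-neg i = trans (/1≡ι (ℤ.- i)) (trans (ι-neg i) (cong -_ (sym (/1≡ι i))))

/1-homo-- : ∀ i j → (i ℤ.- j) / 1 ≡ i / 1 - j / 1
/1-homo-- i j = trans (/1-homo-+ i (ℤ.- j)) (cong (λ r → i / 1 + r) (/1-homo-neg j))

natℚ-homo-+ : ∀ m n → natℚ (m ℕ.+ n) ≡ natℚ m + natℚ n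
natℚ-homo-+ m n = /1-homo-+ (+ m) (+ n)

natℚ-homo-* : ∀ m n → natℚ (m ℕ.* n) ≡ natℚ m * natℚ n
natℚ-homo-* m n = trans (cong (_/ 1) (ℤP.pos-* m n)) (/1-homo-* (+ m) (+ n))

natℚ-ratio : ∀ a b c d → b ℕ.* suc d ≡ c ℕ.* a → natℚ b ≡ ((+ a) / suc d) * natℚ c
natℚ-ratio a b c d eq = ℚP.toℚᵘ-injective (ℚᵘP.≃-trans lhs≃ (ℚᵘP.≃-sym rhs≃))
  where
  cross : + b ℤ.* + (suc d ℕ.* 1) ≡ (+ a ℤ.* + c) ℤ.* + 1
  cross = begin
    + b ℤ.* + (suc d ℕ.* 1) ≡⟨ cong (λ t → + b ℤ.* + t) (ℕP.*-identityʳ (suc d)) ⟩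
    + b ℤ.* + suc d         ≡⟨ ℤP.pos-* b (suc d) ⟨
    + (b ℕ.* suc d)         ≡⟨ cong +_ (trans eq (ℕP.*-comm c a)) ⟩
    + (a ℕ.* c)             ≡⟨ ℤP.pos-* a c ⟩
    + a ℤ.* + c             ≡⟨ ℤP.*-identityʳ (+ a ℤ.* + c) ⟨
    (+ a ℤ.* + c) ℤ.* + 1   ∎

  a/[d+1]·c : ℚᵘ.ℚᵘ
  a/[d+1]·c = ℚᵘ.mkℚᵘ (+ a) d ℚᵘ.* ℚᵘ.mkℚᵘ (+ c) 0

  lhs≃ : toℚᵘ (natℚ b) ℚᵘ.≃ a/[d+1]·c
  lhs≃ = ℚᵘP.≃-trans (ℚP.toℚᵘ-fromℚᵘ (ℚᵘ.mkℚᵘ (+ b) 0)) (ℚᵘ.*≡* cross)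

  rhs≃ : toℚᵘ (((+ a) / suc d) * natℚ c) ℚᵘ.≃ a/[d+1]·c
  rhs≃ = ℚᵘP.≃-trans (ℚP.toℚᵘ-homo-* ((+ a) / suc d) (natℚ c))
           (ℚᵘP.*-cong (ℚP.toℚᵘ-fromℚᵘ (ℚᵘ.mkℚᵘ (+ a) d)) (ℚP.toℚᵘ-fromℚᵘ (ℚᵘ.mkℚᵘ (+ c) 0)))

natℚ-recip : ∀ n .{{_ : NonZero n}} → natℚ n * recipℕ n ≡ 1ℚ
natℚ-recip (suc n) = trans (ℚP.*-comm (natℚ (suc n)) _)
  (sym (natℚ-ratio 1 1 (suc n) n (trans (ℕP.*-identityˡ (suc n)) (sym (ℕP.*-identityʳ (suc n))))))

binomial-factorial : ∀ m p → ((m ℕ.+ p) C p) ℕ.* (p ! ℕ.* m !) ≡ (m ℕ.+ p) !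
binomial-factorial m p = begin
  (n C p) ℕ.* (p ! ℕ.* m !)   ≡⟨ cong (λ t → (n C p) ℕ.* (p ! ℕ.* t !)) (ℕP.m+n∸n≡m m p) ⟨
  (n C p) ℕ.* d               ≡⟨ cong (ℕ._* d) (nCk≡n!/k![n-k]! p≤n) ⟩
  (n ! ℕ./ d) {{d≢0}} ℕ.* d   ≡⟨ m/n*n≡m {{d≢0}} (k![n∸k]!∣n! p≤n) ⟩
  n !                         ∎
  where
  n d : ℕ
  n = m ℕ.+ p
  d = p ! ℕ.* (n ℕ.∸ p) !

  d≢0 : NonZero d
  d≢0 = ℕP._!*_!≢0 p (n ℕ.∸ p)

  p≤n : p ≤ n
  p≤n = ℕP.m≤n+m p m

binomial-nonZero : ∀ m p → NonZero ((m ℕ.+ p) C p)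
binomial-nonZero m p = ℕP.m*n≢0⇒m≢0 ((m ℕ.+ p) C p)
  {{subst NonZero (sym (binomial-factorial m p)) ((m ℕ.+ p) ℕP.!≢0)}}

-- Absorption: C(m+p,p)·(m+p+1) = C(m+1+p,p)·(m+1); both sides times p!·m! are (m+p+1)!.
binomial-absorption : ∀ m p → ((m ℕ.+ p) C p) ℕ.* suc (m ℕ.+ p) ≡ ((suc m ℕ.+ p) C p) ℕ.* suc m
binomial-absorption m p = ℕP.*-cancelʳ-≡ _ _ (p ! ℕ.* m !) {{ℕP._!*_!≢0 p m}} (begin
  C₀ ℕ.* suc (m ℕ.+ p) ℕ.* (p ! ℕ.* m !)  ≡⟨ xy∙z≈y∙xz C₀ (suc (m ℕ.+ p)) (p ! ℕ.* m !) ⟩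
  suc (m ℕ.+ p) ℕ.* (C₀ ℕ.* (p ! ℕ.* m !)) ≡⟨ cong (suc (m ℕ.+ p) ℕ.*_) (binomial-factorial m p) ⟩
  suc (m ℕ.+ p) !                          ≡⟨ binomial-factorial (suc m) p ⟨
  C₁ ℕ.* (p ! ℕ.* (suc m ℕ.* m !))         ≡⟨ cong (C₁ ℕ.*_) (x∙yz≈y∙xz (p !) (suc m) (m !)) ⟩
  C₁ ℕ.* (suc m ℕ.* (p ! ℕ.* m !))         ≡⟨ ℕP.*-assoc C₁ (suc m) (p ! ℕ.* m !) ⟨
  C₁ ℕ.* suc m ℕ.* (p ! ℕ.* m !)          ∎)
  where
  C₀ C₁ : ℕ
  C₀ = (m ℕ.+ p) C p
  C₁ = (suc m ℕ.+ p) C p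

sumTo-cong : ∀ n {f g : ℕ → ℚ} → (∀ k → k ≤ n → f k ≡ g k) → sumTo n f ≡ sumTo n g
sumTo-cong zero    f≗g = f≗g 0 z≤n
sumTo-cong (suc n) f≗g =
  cong₂ _+_ (sumTo-cong n (λ k k≤n → f≗g k (ℕP.m≤n⇒m≤1+n k≤n))) (f≗g (suc n) ℕP.≤-refl)

sumTo-+ : ∀ n f g → sumTo n (λ k → f k + g k) ≡ sumTo n f + sumTo n g
sumTo-+ zero    f g = refl
sumTo-+ (suc n) f g = begin
  sumTo n (λ k → f k + g k) + (f (suc n) + g (suc n))   ≡⟨ cong (_+ (f (suc n) + g (suc n))) (sumTo-+ n f g) ⟩
  (sumTo n f + sumTo n g) + (f (suc n) + g (suc n))     ≡⟨ +-interchange (sumTo n f) (sumTo n g) (f (suc n)) (g (suc n)) ⟩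
  (sumTo n f + f (suc n)) + (sumTo n g + g (suc n))     ∎

sumTo-*ˡ : ∀ n c f → sumTo n (λ k → c * f k) ≡ c * sumTo n f
sumTo-*ˡ zero    c f = refl
sumTo-*ˡ (suc n) c f = begin
  sumTo n (λ k → c * f k) + c * f (suc n) ≡⟨ cong (_+ c * f (suc n)) (sumTo-*ˡ n c f) ⟩
  c * sumTo n f + c * f (suc n)           ≡⟨ ℚP.*-distribˡ-+ c (sumTo n f) (f (suc n)) ⟨
  c * (sumTo n f + f (suc n))             ∎

sumTo-neg : ∀ n f → sumTo n (λ k → - f k) ≡ - sumTo n f
sumTo-neg zero    f = refl
sumTo-neg (suc n) f = trans (cong (_+ - f (suc n)) (sumTo-neg n f)) (sym (ℚP.neg-distrib-+ (sumTo n f) (f (suc n))))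

sumTo-- : ∀ n f g → sumTo n (λ k → f k - g k) ≡ sumTo n f - sumTo n g
sumTo-- n f g = trans (sumTo-+ n f (λ k → - g k)) (cong (λ t → sumTo n f + t) (sumTo-neg n g))

sumTo-shift : ∀ n f → sumTo (suc n) f ≡ f 0 + sumTo n (λ k → f (suc k))
sumTo-shift zero    f = refl
sumTo-shift (suc n) f = trans (cong (_+ f (suc (suc n))) (sumTo-shift n f)) (ℚP.+-assoc (f 0) _ _)

sumTo-dropLast : ∀ n f → f (suc n) ≡ 0ℚ → sumTo (suc n) f ≡ sumTo n f
sumTo-dropLast n f f[n+1]≡0 = trans (cong (λ t → sumTo n f + t) f[n+1]≡0) (ℚP.+-identityʳ (sumTo n f))

sumTo-reindex : ∀ n f → f 0 ≡ 0ℚ → f (suc n) ≡ 0ℚ → sumTo n f ≡ sumTo n (λ k → f (suc k))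
sumTo-reindex n f f0≡0 f[n+1]≡0 = begin
  sumTo n f                           ≡⟨ sumTo-dropLast n f f[n+1]≡0 ⟨
  sumTo (suc n) f                     ≡⟨ sumTo-shift n f ⟩
  f 0 + sumTo n (λ k → f (suc k))     ≡⟨ cong (_+ sumTo n (λ k → f (suc k))) f0≡0 ⟩
  0ℚ + sumTo n (λ k → f (suc k))      ≡⟨ ℚP.+-identityˡ _ ⟩
  sumTo n (λ k → f (suc k))           ∎

s₁ : ℕ → ℕ → ℚ
s₁ m k = stirling1 m k / 1

stirling1-above : ∀ {m k} → m < k → stirling1 m k ≡ + 0
stirling1-above {zero}  {suc k} _ = refl
stirling1-above {suc m} {suc k} (s≤s m<k)
  rewrite stirling1-above m<k | stirling1-above (ℕP.m<n⇒m<1+n m<k) | ℤP.*-zeroʳ (+ m) = refl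

stirling2-above : ∀ {m k} → m < k → stirling2 m k ≡ 0
stirling2-above {zero}  {suc k} _ = refl
stirling2-above {suc m} {suc k} (s≤s m<k)
  rewrite stirling2-above m<k | stirling2-above (ℕP.m<n⇒m<1+n m<k) | ℕP.*-zeroʳ k = refl

s₁-rec : ∀ m k → s₁ (suc m) (suc k) ≡ s₁ m k - natℚ m * s₁ m (suc k)
s₁-rec m k = trans (/1-homo-- (stirling1 m k) _) (cong (λ t → s₁ m k - t) (/1-homo-* (+ m) _))

stirling2-rec : ∀ n k → natℚ (stirling2 (suc n) (suc k))
                        ≡ natℚ (suc k) * natℚ (stirling2 n (suc k)) + natℚ (stirling2 n k)
stirling2-rec n k = trans (natℚ-homo-+ (suc k ℕ.* stirling2 n (suc k)) (stirling2 n k))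
  (cong (_+ natℚ (stirling2 n k)) (natℚ-homo-* (suc k) (stirling2 n (suc k))))

m·s₁[m,0]≡0 : ∀ m x → natℚ m * (s₁ m 0 * x) ≡ 0ℚ
m·s₁[m,0]≡0 zero    x = ℚP.*-zeroˡ (s₁ 0 0 * x)
m·s₁[m,0]≡0 (suc m) x = trans (cong (natℚ (suc m) *_) (ℚP.*-zeroˡ x)) (ℚP.*-zeroʳ (natℚ (suc m)))

stirling1Transform : (ℕ → ℚ) → ℕ → ℚ
stirling1Transform b m = sumTo m (λ k → s₁ m k * b k)

stirling2Transform : (ℕ → ℚ) → ℕ → ℚ
stirling2Transform a n = sumTo n (λ j → natℚ (stirling2 n j) * a j)

stirling1Transform-cong : ∀ {b b′} m → (∀ k → b k ≡ b′ k) → stirling1Transform b m ≡ stirling1Transform b′ m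
stirling1Transform-cong m b≗b′ = sumTo-cong m (λ k _ → cong (s₁ m k *_) (b≗b′ k))

-- From x^{(m+1)} = x^{(m)}·(x - m):  (s b)_{m+1} = (s (b ∘ suc))_m − m·(s b)_m.
stirling1Transform-step : ∀ b m → stirling1Transform b (suc m)
                          ≡ stirling1Transform (λ k → b (suc k)) m - natℚ m * stirling1Transform b m
stirling1Transform-step b m = begin
  stirling1Transform b (suc m)
    ≡⟨ sumTo-shift m (λ k → s₁ (suc m) k * b k) ⟩
  s₁ (suc m) 0 * b 0 + sumTo m (λ k → s₁ (suc m) (suc k) * b (suc k))
    ≡⟨ cong₂ _+_ (ℚP.*-zeroˡ (b 0)) (sumTo-cong m (λ k _ → term k)) ⟩
  0ℚ + sumTo m (λ k → s₁ m k * b (suc k) - m·term (suc k))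
    ≡⟨ ℚP.+-identityˡ _ ⟩
  sumTo m (λ k → s₁ m k * b (suc k) - m·term (suc k))
    ≡⟨ sumTo-- m (λ k → s₁ m k * b (suc k)) (λ k → m·term (suc k)) ⟩
  T′ - sumTo m (λ k → m·term (suc k))
    ≡⟨ cong (λ t → T′ - t) (sym (sumTo-reindex m m·term (m·s₁[m,0]≡0 m (b 0)) m·term[m+1]≡0)) ⟩
  T′ - sumTo m m·term
    ≡⟨ cong (λ t → T′ - t) (sumTo-*ˡ m (natℚ m) (λ k → s₁ m k * b k)) ⟩
  T′ - natℚ m * stirling1Transform b m ∎
  where
  T′ : ℚ
  T′ = stirling1Transform (λ k → b (suc k)) m

  m·term : ℕ → ℚ
  m·term k = natℚ m * (s₁ m k * b k)

  m·term[m+1]≡0 : m·term (suc m) ≡ 0ℚ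
  m·term[m+1]≡0 = begin
    natℚ m * (s₁ m (suc m) * b (suc m)) ≡⟨ cong (λ t → natℚ m * (t / 1 * b (suc m))) (stirling1-above (ℕP.n<1+n m)) ⟩
    natℚ m * (0ℚ * b (suc m))           ≡⟨ cong (natℚ m *_) (ℚP.*-zeroˡ (b (suc m))) ⟩
    natℚ m * 0ℚ                         ≡⟨ ℚP.*-zeroʳ (natℚ m) ⟩
    0ℚ                                  ∎

  term : ∀ k → s₁ (suc m) (suc k) * b (suc k) ≡ s₁ m k * b (suc k) - m·term (suc k)
  term k rewrite s₁-rec m k =
    solve 4 (λ s n s′ y → (s :- n :* s′) :* y := s :* y :- n :* (s′ :* y)) refl (s₁ m k) (natℚ m) (s₁ m (suc k)) (b (suc k))

-- From S(n+1,j+1) = (j+1)·S(n,j+1) + S(n,j):  (S a)_{n+1} = (S a′)_n  with  a′_j = j·a_j + a_{j+1}.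
stirling2Transform-step : ∀ a n → stirling2Transform a (suc n)
                          ≡ stirling2Transform (λ j → natℚ j * a j + a (suc j)) n
stirling2Transform-step a n = begin
  stirling2Transform a (suc n)
    ≡⟨ sumTo-shift n (λ j → natℚ (stirling2 (suc n) j) * a j) ⟩
  0ℚ * a 0 + sumTo n (λ j → natℚ (stirling2 (suc n) (suc j)) * a (suc j))
    ≡⟨ cong₂ _+_ (ℚP.*-zeroˡ (a 0)) (sumTo-cong n (λ j _ → term j)) ⟩
  0ℚ + sumTo n (λ j → S·ja (suc j) + S·a′ j)
    ≡⟨ ℚP.+-identityˡ _ ⟩
  sumTo n (λ j → S·ja (suc j) + S·a′ j)
    ≡⟨ sumTo-+ n (λ j → S·ja (suc j)) S·a′ ⟩
  sumTo n (λ j → S·ja (suc j)) + sumTo n S·a′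
    ≡⟨ cong (_+ sumTo n S·a′) (sym (sumTo-reindex n S·ja S·ja[0]≡0 S·ja[n+1]≡0)) ⟩
  sumTo n S·ja + sumTo n S·a′
    ≡⟨ sym (sumTo-+ n S·ja S·a′) ⟩
  sumTo n (λ j → S·ja j + S·a′ j)
    ≡⟨ sumTo-cong n (λ j _ → sym (ℚP.*-distribˡ-+ (natℚ (stirling2 n j)) _ _)) ⟩
  stirling2Transform (λ j → natℚ j * a j + a (suc j)) n ∎
  where
  S·ja S·a′ : ℕ → ℚ
  S·ja j = natℚ (stirling2 n j) * (natℚ j * a j)
  S·a′ j = natℚ (stirling2 n j) * a (suc j)

  S·ja[0]≡0 : S·ja 0 ≡ 0ℚ
  S·ja[0]≡0 = trans (cong (natℚ (stirling2 n 0) *_) (ℚP.*-zeroˡ (a 0))) (ℚP.*-zeroʳ (natℚ (stirling2 n 0)))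

  S·ja[n+1]≡0 : S·ja (suc n) ≡ 0ℚ
  S·ja[n+1]≡0 = trans (cong (λ t → natℚ t * (natℚ (suc n) * a (suc n))) (stirling2-above (ℕP.n<1+n n)))
                      (ℚP.*-zeroˡ (natℚ (suc n) * a (suc n)))

  term : ∀ j → natℚ (stirling2 (suc n) (suc j)) * a (suc j) ≡ S·ja (suc j) + S·a′ j
  term j rewrite stirling2-rec n j =
    solve 4 (λ i S S′ y → (i :* S :+ S′) :* y := S :* (i :* y) :+ S′ :* y) refl
      (natℚ (suc j)) (natℚ (stirling2 n (suc j))) (natℚ (stirling2 n j)) (a (suc j))

-- Stirling inversion: the first-kind transform undoes the second-kind one,
-- Σ_{k≤m} s(m,k) Σ_{j≤k} S(k,j) a_j = a_m.  Induction on m, for all a at once.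
stirling-inversion : ∀ m a → stirling1Transform (stirling2Transform a) m ≡ a m
stirling-inversion zero    a = trans (ℚP.*-identityˡ _) (ℚP.*-identityˡ (a 0))
stirling-inversion (suc m) a = begin
  stirling1Transform (stirling2Transform a) (suc m)
    ≡⟨ stirling1Transform-step (stirling2Transform a) m ⟩
  stirling1Transform (λ k → stirling2Transform a (suc k)) m - natℚ m * stirling1Transform (stirling2Transform a) m
    ≡⟨ cong₂ (λ u v → u - natℚ m * v)
         (trans (stirling1Transform-cong m (stirling2Transform-step a)) (stirling-inversion m a′))
         (stirling-inversion m a) ⟩
  (natℚ m * a m + a (suc m)) - natℚ m * a m
    ≡⟨ solve 2 (λ u v → (u :+ v) :- u := v) refl (natℚ m * a m) (a (suc m)) ⟩
  a (suc m) ∎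
  where
  a′ : ℕ → ℚ
  a′ j = natℚ j * a j + a (suc j)

-- Z_{n,m}(p) = C(m+p,p) · (s b)_m  with  b_k = B_{n+k,p},  and  B_{k,p} = (S a)_k  with
-- a_j = C(j+p,p)⁻¹.  So for n = 0 Stirling inversion leaves C(m+p,p) · C(m+p,p)⁻¹.
Zn-zero : ∀ m p → Zn 0 m p ≡ 1ℚ
Zn-zero m p = begin
  natℚ ((m ℕ.+ p) C p) * stirling1Transform (stirling2Transform a) m
    ≡⟨ cong (natℚ ((m ℕ.+ p) C p) *_) (stirling-inversion m a) ⟩
  natℚ ((m ℕ.+ p) C p) * recipℕ ((m ℕ.+ p) C p)
    ≡⟨ natℚ-recip ((m ℕ.+ p) C p) {{binomial-nonZero m p}} ⟩
  1ℚ ∎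
  where
  a : ℕ → ℚ
  a j = recipℕ ((j ℕ.+ p) C p)

-- Z_{n+1,m}(p) = (m+1)/(m+p+1) · Z_{n,m+1}(p) + m · Z_{n,m}(p): the transform step applied to
-- b_k = B_{n+k,p}, with the binomial prefactors related by absorption.
Zn-rec : ∀ n m p → Zn (suc n) m p ≡ ((+ suc m) / suc (m ℕ.+ p)) * Zn n (suc m) p + natℚ m * Zn n m p
Zn-rec n m p = begin
  C₀ * stirling1Transform (λ k → pBell (suc n ℕ.+ k) p) m
    ≡⟨ cong (C₀ *_) (stirling1Transform-cong m (λ k → cong (λ t → pBell t p) (sym (ℕP.+-suc n k)))) ⟩
  C₀ * stirling1Transform (λ k → b (suc k)) m
    ≡⟨ cong₂ _*_ C₀≡q·C₁ (solve 3 (λ x y z → x := (x :- y :* z) :+ y :* z) refl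
                          (stirling1Transform (λ k → b (suc k)) m) (natℚ m) (stirling1Transform b m)) ⟩
  (q * C₁) * ((stirling1Transform (λ k → b (suc k)) m - natℚ m * stirling1Transform b m) + natℚ m * stirling1Transform b m)
    ≡⟨ cong (λ t → (q * C₁) * (t + natℚ m * stirling1Transform b m)) (sym (stirling1Transform-step b m)) ⟩
  (q * C₁) * (stirling1Transform b (suc m) + natℚ m * stirling1Transform b m)
    ≡⟨ solve 5 (λ q c t m t′ → (q :* c) :* (t :+ m :* t′) := q :* (c :* t) :+ m :* ((q :* c) :* t′)) refl
         q C₁ (stirling1Transform b (suc m)) (natℚ m) (stirling1Transform b m) ⟩
  q * Zn n (suc m) p + natℚ m * ((q * C₁) * stirling1Transform b m)
    ≡⟨ cong (λ t → q * Zn n (suc m) p + natℚ m * (t * stirling1Transform b m)) (sym C₀≡q·C₁) ⟩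
  q * Zn n (suc m) p + natℚ m * Zn n m p ∎
  where
  C₀ C₁ q : ℚ
  C₀ = natℚ ((m ℕ.+ p) C p)
  C₁ = natℚ ((suc m ℕ.+ p) C p)
  q  = (+ suc m) / suc (m ℕ.+ p)

  b : ℕ → ℚ
  b k = pBell (n ℕ.+ k) p

  C₀≡q·C₁ : C₀ ≡ q * C₁
  C₀≡q·C₁ = natℚ-ratio (suc m) ((m ℕ.+ p) C p) ((suc m ℕ.+ p) C p) (m ℕ.+ p) (binomial-absorption m p)

binomialSeries : ℕ → (ℕ → ℚ) → ℚ → ℚ
binomialSeries n c x = sumTo n (λ k → natℚ (n C k) * c k * pow x (n ℕ.∸ k))

-- Appell property: by Pascal's rule the series of degree n+1 splits as
-- (series of the shifted sequence) + x · (series of degree n).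
binomialSeries-step : ∀ n c x →
  binomialSeries (suc n) c x ≡ binomialSeries n (λ k → c (suc k)) x + x * binomialSeries n c x
binomialSeries-step n c x = begin
  binomialSeries (suc n) c x
    ≡⟨ sumTo-shift n (λ k → natℚ (suc n C k) * c k * pow x (suc n ℕ.∸ k)) ⟩
  u 0 + sumTo n (λ k → natℚ (suc n C suc k) * c (suc k) * pow x (n ℕ.∸ k))
    ≡⟨ cong (λ t → u 0 + t) (sumTo-cong n (λ k _ → pascal k)) ⟩
  u 0 + sumTo n (λ k → v k + u (suc k))
    ≡⟨ cong (λ t → u 0 + t) (sumTo-+ n v (λ k → u (suc k))) ⟩
  u 0 + (S′ + sumTo n (λ k → u (suc k)))
    ≡⟨ solve 3 (λ a b c → a :+ (b :+ c) := b :+ (a :+ c)) refl (u 0) (S′) _ ⟩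
  S′ + (u 0 + sumTo n (λ k → u (suc k)))
    ≡⟨ cong (λ t → S′ + t) (sym (sumTo-shift n u)) ⟩
  S′ + sumTo (suc n) u
    ≡⟨ cong (λ t → S′ + t) (sumTo-dropLast n u u[n+1]≡0) ⟩
  S′ + sumTo n u
    ≡⟨ cong (λ t → S′ + t) x·series ⟩
  S′ + x * binomialSeries n c x ∎
  where
  S′ : ℚ
  S′ = binomialSeries n (λ k → c (suc k)) x

  u v : ℕ → ℚ
  u k = natℚ (n C k) * c k * pow x (suc n ℕ.∸ k)
  v k = natℚ (n C k) * c (suc k) * pow x (n ℕ.∸ k)

  pascal : ∀ k → natℚ (suc n C suc k) * c (suc k) * pow x (n ℕ.∸ k) ≡ v k + u (suc k)
  pascal k = begin
    natℚ (suc n C suc k) * c (suc k) * pow x (n ℕ.∸ k)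
      ≡⟨ cong (λ t → natℚ t * c (suc k) * pow x (n ℕ.∸ k)) (sym (nCk+nC[k+1]≡[n+1]C[k+1] n k)) ⟩
    natℚ ((n C k) ℕ.+ (n C suc k)) * c (suc k) * pow x (n ℕ.∸ k)
      ≡⟨ cong (λ t → t * c (suc k) * pow x (n ℕ.∸ k)) (natℚ-homo-+ (n C k) (n C suc k)) ⟩
    (natℚ (n C k) + natℚ (n C suc k)) * c (suc k) * pow x (n ℕ.∸ k)
      ≡⟨ solve 4 (λ a b y w → (a :+ b) :* y :* w := a :* y :* w :+ b :* y :* w) refl
           (natℚ (n C k)) (natℚ (n C suc k)) (c (suc k)) (pow x (n ℕ.∸ k)) ⟩
    v k + u (suc k) ∎

  u[n+1]≡0 : u (suc n) ≡ 0ℚ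
  u[n+1]≡0 = begin
    natℚ (n C suc n) * c (suc n) * w ≡⟨ cong (λ t → natℚ t * c (suc n) * w) (k>n⇒nCk≡0 (ℕP.n<1+n n)) ⟩
    0ℚ * c (suc n) * w               ≡⟨ cong (_* w) (ℚP.*-zeroˡ (c (suc n))) ⟩
    0ℚ * w                           ≡⟨ ℚP.*-zeroˡ w ⟩
    0ℚ                               ∎
    where w = pow x (n ℕ.∸ n)

  x·series : sumTo n u ≡ x * binomialSeries n c x
  x·series = trans (sumTo-cong n (λ k k≤n → x·term k k≤n)) (sumTo-*ˡ n x _)
    where
    x·term : ∀ k → k ≤ n → u k ≡ x * (natℚ (n C k) * c k * pow x (n ℕ.∸ k))
    x·term k k≤n = begin
      natℚ (n C k) * c k * pow x (suc n ℕ.∸ k)   ≡⟨ cong (λ t → natℚ (n C k) * c k * pow x t) (ℕP.+-∸-assoc 1 k≤n) ⟩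
      natℚ (n C k) * c k * (x * pow x (n ℕ.∸ k)) ≡⟨ solve 4 (λ a y x w → a :* y :* (x :* w) := x :* (a :* y :* w)) refl
                                                      (natℚ (n C k)) (c k) x (pow x (n ℕ.∸ k)) ⟩
      x * (natℚ (n C k) * c k * pow x (n ℕ.∸ k)) ∎

binomialSeries-linear : ∀ n α β c d x →
  binomialSeries n (λ k → α * d k + β * c k) x ≡ α * binomialSeries n d x + β * binomialSeries n c x
binomialSeries-linear n α β c d x = begin
  binomialSeries n (λ k → α * d k + β * c k) x
    ≡⟨ sumTo-cong n (λ k _ → solve 6 (λ a α d β c w → a :* (α :* d :+ β :* c) :* w := α :* (a :* d :* w) :+ β :* (a :* c :* w))
                               refl (natℚ (n C k)) α (d k) β (c k) (pow x (n ℕ.∸ k))) ⟩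
  sumTo n (λ k → α * term d k + β * term c k)
    ≡⟨ sumTo-+ n (λ k → α * term d k) (λ k → β * term c k) ⟩
  sumTo n (λ k → α * term d k) + sumTo n (λ k → β * term c k)
    ≡⟨ cong₂ _+_ (sumTo-*ˡ n α (term d)) (sumTo-*ˡ n β (term c)) ⟩
  α * binomialSeries n d x + β * binomialSeries n c x ∎
  where
  term : (ℕ → ℚ) → ℕ → ℚ
  term e k = natℚ (n C k) * e k * pow x (n ℕ.∸ k)

binomialSeries-rec : ∀ (c d : ℕ → ℚ) (α β x : ℚ) → (∀ k → c (suc k) ≡ α * d k + β * c k) →
  ∀ n → binomialSeries (suc n) c x ≡ α * binomialSeries n d x + (β + x) * binomialSeries n c x
binomialSeries-rec c d α β x c-rec n = begin
  binomialSeries (suc n) c x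
    ≡⟨ binomialSeries-step n c x ⟩
  binomialSeries n (λ k → c (suc k)) x + x * binomialSeries n c x
    ≡⟨ cong (_+ x * binomialSeries n c x)
         (sumTo-cong n (λ k _ → cong (λ t → natℚ (n C k) * t * pow x (n ℕ.∸ k)) (c-rec k))) ⟩
  binomialSeries n (λ k → α * d k + β * c k) x + x * binomialSeries n c x
    ≡⟨ cong (_+ x * binomialSeries n c x) (binomialSeries-linear n α β c d x) ⟩
  α * binomialSeries n d x + β * binomialSeries n c x + x * binomialSeries n c x
    ≡⟨ solve 5 (λ α D β C x → α :* D :+ β :* C :+ x :* C := α :* D :+ (β :+ x) :* C) refl
         α (binomialSeries n d x) β (binomialSeries n c x) x ⟩
  α * binomialSeries n d x + (β + x) * binomialSeries n c x ∎

-- Z_{n,m}(x;p) is the binomial series of k ↦ Z_{k,m}(p), so the recurrence of Z_{k,m}(p)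
-- lifts to the polynomials; in degree 0 only the constant term Z_{0,m}(p) = 1 remains.
mainTheorem17 : (∀ (n m p : ℕ) (x : ℚ) →
                  Zpoly (suc n) m p x
                    ≡ ((+ suc m) / suc (m ℕ.+ p)) * Zpoly n (suc m) p x
                      + (natℚ m + x) * Zpoly n m p x)
                × (∀ (m p : ℕ) (x : ℚ) → Zpoly 0 m p x ≡ 1ℚ)
mainTheorem17 = recurrence , initial
  where
  recurrence : ∀ n m p x → Zpoly (suc n) m p x
                           ≡ ((+ suc m) / suc (m ℕ.+ p)) * Zpoly n (suc m) p x + (natℚ m + x) * Zpoly n m p x
  recurrence n m p x = binomialSeries-rec (λ k → Zn k m p) (λ k → Zn k (suc m) p)
    ((+ suc m) / suc (m ℕ.+ p)) (natℚ m) x (λ k → Zn-rec k m p) n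

  initial : ∀ m p x → Zpoly 0 m p x ≡ 1ℚ
  initial m p x = trans (ℚP.*-identityʳ (1ℚ * Zn 0 m p)) (trans (ℚP.*-identityˡ (Zn 0 m p)) (Zn-zero m p))
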